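{- Let $n\geqslant 3$ and let $G$ be the graph consisting of a cycle $v_1v_2\cdots v_nv_1$ together with an additional vertex $u$ adjacent to exactly $v_1$ and $v_n$. Let $L$ be a list assignment on $V(G)$ with $|L(v)|\geqslant 2$ for every vertex $v$. Then $G$ has a proper vertex coloring $c$ with $c(v)\in L(v)$ for all $v$ provided that either $|L(v_1)|\geqslant 3$, or $n$ is even and $L(v_1)\neq L(u)$.
   Context: A list assignment assigns a set $L(v)$ of colors to each vertex; a proper coloring gives adjacent vertices distinct colors. -}

module Defs where

open import Data.Nat using (ℕ; suc; _+_; _∸_; _<_)
open import Data.Fin using (Fin; toℕ)
open import Data.List using (List; length)
open import Data.List.Membership.Propositional using (_∈_)
open import Data.List.Relation.Unary.Unique.Propositional using (Unique)
open import Data.Product using (_×_)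
open import Data.Sum using (_⊎_)
open import Relation.Binary.PropositionalEquality using (_≡_)
open import Relation.Nullary using (¬_)

-- Vertex with index i < n is v_{i+1} (so index 0 is v_1, index n ∸ 1 is v_n);
-- vertex with index n is u.
CycleEdge : (n : ℕ) → ℕ → ℕ → Set
CycleEdge n i j = (suc i < n × j ≡ suc i) ⊎ (i ≡ n ∸ 1 × j ≡ 0)

UEdge : (n : ℕ) → ℕ → ℕ → Set
UEdge n i j = i ≡ n × (j ≡ 0 ⊎ j ≡ n ∸ 1)

Adj : (n : ℕ) → Fin (suc n) → Fin (suc n) → Set
Adj n x y =
  CycleEdge n (toℕ x) (toℕ y) ⊎ CycleEdge n (toℕ y) (toℕ x)
  ⊎ UEdge n (toℕ x) (toℕ y) ⊎ UEdge n (toℕ y) (toℕ x)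

-- A list assignment: each vertex gets a finite set of colours (colours are
-- natural numbers), represented as a duplicate-free list.
ListAssignment : ℕ → Set
ListAssignment n = Fin (suc n) → List ℕ

-- |L(v)| (meaningful since the lists are required to be duplicate-free).
∣_∣ₗ : List ℕ → ℕ
∣ A ∣ₗ = length A

SameSet : List ℕ → List ℕ → Set
SameSet A B = ∀ (x : ℕ) → (x ∈ A → x ∈ B) × (x ∈ B → x ∈ A)

ProperLColoring : (n : ℕ) → ListAssignment n → (Fin (suc n) → ℕ) → Set
ProperLColoring n L c =
  (∀ v → c v ∈ L v) × (∀ v w → Adj n v w → ¬ (c v ≡ c w))

-- Colours are chosen greedily along paths: a list of size at least 2 always has a
-- colour different from that of the previous vertex.
-- If |L(v₁)| ≥ 3, colour v₂, …, vₙ and then u greedily, and v₁ last; v₁ is blocked only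
-- if v₂, vₙ, u take three distinct colours of L(v₁).  Starting at v₂ with a colour
-- outside L(v₁), or letting u or vₙ take a colour outside L(v₁) or the colour of v₂,
-- prevents this; when neither is possible, L(v₂) and L(u) are disjoint subsets of
-- L(v₁), so |L(v₁)| ≥ 4.
-- If |L(v₁)| = 2 and α ∈ L(u) ∖ L(v₁): when L(vₙ) ⊆ ⋯ ⊆ L(v₁), every list contains
-- L(v₁), whose two colours alternate around the even cycle, and u gets α.  Otherwise
-- some γ ∈ L(vᵢ₊₁) ∖ L(vᵢ); walk from vᵢ₊₁ with γ up to vₙ, then from v₁ up to vᵢ,
-- where γ cannot clash.  The colour of v₁ is the only free choice: it must differ from
-- that of vₙ and leave a colour for u.
module Submission where

open import Defs
open import Data.Nat using (ℕ; zero; suc; _≤_; _<_; _+_; _*_; _∸_; z≤n; s≤s; _≟_; _≤?_)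
open import Data.Nat.Properties
  using (≤-refl; ≤-trans; <⇒≤; <⇒≱; ≰⇒>; n<1+n; m<n⇒m<1+n; m<1+n⇒m<n∨m≡n; m≤n⇒m<n∨m≡n;
         <-cmp; +-mono-≤; n∸n≡0; m∸n+n≡m; +-∸-assoc; m⊓n≤n; m≤n⇒m⊓n≡m)
open import Data.Nat.Divisibility using (_∣_; divides)
open import Data.Fin using (Fin; zero; fromℕ; fromℕ<; toℕ)
open import Data.Fin.Properties using (toℕ-injective; toℕ-fromℕ<; toℕ-fromℕ; toℕ≤pred[n])
open import Data.List using (List; []; _∷_; _++_; length; filter)
open import Data.List.Properties using (length-++; filter-notAll)
open import Data.List.Membership.Propositional using (_∈_; _∉_; find; lose)
open import Data.List.Membership.Propositional.Properties using (∈-filter⁺; ∈-++⁻)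
open import Data.List.Membership.DecPropositional _≟_ using (_∈?_)
open import Data.List.Relation.Binary.Subset.Propositional using (_⊆_)
open import Data.List.Relation.Binary.Disjoint.Propositional using (Disjoint)
open import Data.List.Relation.Unary.Any as Any using (Any; here; there; any?)
open import Data.List.Relation.Unary.All as All using ()
open import Data.List.Relation.Unary.All.Properties using (¬Any⇒All¬)
open import Data.List.Relation.Unary.AllPairs using (_∷_)
open import Data.List.Relation.Unary.Unique.Propositional using (Unique)
open import Data.List.Relation.Unary.Unique.Propositional.Properties using (++⁺)
open import Data.Product as Prod using (Σ; ∃-syntax; _×_; _,_; proj₁; proj₂)
open import Data.Sum as Sum using (_⊎_; inj₁; inj₂; [_,_]′)
open import Function using (id; _∘_)
open import Relation.Nullary using (¬_; yes; no; ¬?; contradiction)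
open import Relation.Nullary.Decidable using (decidable-stable)
open import Relation.Binary.PropositionalEquality
  using (_≡_; _≢_; refl; sym; trans; cong; subst; subst₂; ≢-sym)
open import Relation.Binary.Definitions using (tri<; tri≈; tri>)

infix 4 _⊈_

_⊈_ : List ℕ → List ℕ → Set
A ⊈ B = Any (_∉ B) A

⊈-or-⊆ : ∀ A B → A ⊈ B ⊎ A ⊆ B
⊈-or-⊆ A B with any? (λ x → ¬? (x ∈? B)) A
... | yes A⊈B = inj₁ A⊈B
... | no ¬A⊈B = inj₂ λ x∈A → decidable-stable (_ ∈? B) (¬A⊈B ∘ lose x∈A)

⊈-∷ : ∀ {A S y} → y ∈ S → A ⊈ S → A ⊈ (y ∷ S)
⊈-∷ y∈S = Any.map λ { x∉S (here refl) → x∉S y∈S ; x∉S (there x∈S) → x∉S x∈S }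

⊆⇒length≤ : ∀ {A B : List ℕ} → Unique A → A ⊆ B → length A ≤ length B
⊆⇒length≤ {[]} _ _ = z≤n
⊆⇒length≤ {x ∷ A} {B} (x∉A ∷ uA) x∷A⊆B =
  ≤-trans (s≤s (⊆⇒length≤ uA A⊆B∖x))
          (filter-notAll ≢x? B (Any.map (λ x≡y y≢x → y≢x (sym x≡y)) (x∷A⊆B (here refl))))
  where
  ≢x? = λ y → ¬? (y ≟ x)
  A⊆B∖x : A ⊆ filter ≢x? B
  A⊆B∖x y∈A = ∈-filter⁺ ≢x? (x∷A⊆B (there y∈A)) (λ y≡x → All.lookup x∉A y∈A (sym y≡x))

length<⇒⊈ : ∀ {A B} → Unique A → length B < length A → A ⊈ B
length<⇒⊈ {A} {B} uA |B|<|A| with ⊈-or-⊆ A B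
... | inj₁ A⊈B = A⊈B
... | inj₂ A⊆B = contradiction (⊆⇒length≤ uA A⊆B) (<⇒≱ |B|<|A|)

-- A colour of S outside A makes |S ∩ A| < |S|.
length≤⇒⊈ : ∀ {A S} → Unique A → S ⊈ A → length S ≤ length A → A ⊈ S
length≤⇒⊈ {A} {S} uA S⊈A |S|≤|A|
  with find (length<⇒⊈ uA (≤-trans (filter-notAll (_∈? A) S S⊈A) |S|≤|A|))
... | x , x∈A , x∉S∩A = lose x∈A λ x∈S → x∉S∩A (∈-filter⁺ (_∈? A) x∈S x∈A)

⊆∧length≤⇒⊇ : ∀ {A B} → Unique A → A ⊆ B → length B ≤ length A → B ⊆ A
⊆∧length≤⇒⊇ {A} uA A⊆B |B|≤|A| {x} x∈B with x ∈? A
... | yes x∈A = x∈A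
... | no x∉A = contradiction
  (⊆⇒length≤ (¬Any⇒All¬ A x∉A ∷ uA) λ { (here refl) → x∈B ; (there y∈A) → A⊆B y∈A })
  (<⇒≱ (s≤s |B|≤|A|))

disjoint-⊆⇒length+length≤ : ∀ {A B C} → Unique A → Unique B → Disjoint A B
  → A ⊆ C → B ⊆ C → length A + length B ≤ length C
disjoint-⊆⇒length+length≤ {A} uA uB A∩B≡∅ A⊆C B⊆C =
  subst (_≤ _) (length-++ A) (⊆⇒length≤ (++⁺ uA uB A∩B≡∅) A++B⊆C)
  where
  A++B⊆C : A ++ _ ⊆ _
  A++B⊆C = [ A⊆C , B⊆C ]′ ∘ ∈-++⁻ A

avoid : List ℕ → List ℕ → ℕ
avoid [] S = 0
avoid (x ∷ A) S with x ∈? S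
... | yes _ = avoid A S
... | no _ = x

avoid-∈∉ : ∀ {A S} → A ⊈ S → avoid A S ∈ A × avoid A S ∉ S
avoid-∈∉ {x ∷ A} {S} A⊈S with x ∈? S | A⊈S
... | no x∉S | _ = here refl , x∉S
... | yes x∈S | here x∉S = contradiction x∈S x∉S
... | yes _ | there A⊈S′ with avoid-∈∉ A⊈S′
...   | ∈A , ∉S = there ∈A , ∉S

glue : ℕ → (ℕ → ℕ) → (ℕ → ℕ) → ℕ → ℕ
glue i g h j with j ≤? i
... | yes _ = g j
... | no _ = h j

glue-≤ : ∀ {i j g h} → j ≤ i → glue i g h j ≡ g j
glue-≤ {i} {j} j≤i with j ≤? i
... | yes _ = refl
... | no j≰i = contradiction j≤i j≰i

glue-> : ∀ {i j g h} → i < j → glue i g h j ≡ h j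
glue-> {i} {j} i<j with j ≤? i
... | yes j≤i = contradiction j≤i (<⇒≱ i<j)
... | no _ = refl

alternate : {A : Set} → A → A → ℕ → A
alternate p q zero = p
alternate p q (suc j) = alternate q p j

alternate-≢ : ∀ {A : Set} {p q : A} → p ≢ q → ∀ j → alternate p q j ≢ alternate p q (suc j)
alternate-≢ p≢q zero = p≢q
alternate-≢ p≢q (suc j) = alternate-≢ (≢-sym p≢q) j

alternate-even : ∀ {A : Set} {p q : A} k → alternate p q (k * 2) ≡ p
alternate-even zero = refl
alternate-even (suc k) = alternate-even k

alternate-preserves : ∀ {A : Set} {P : A → Set} {p q} → P p → P q → ∀ j → P (alternate p q j)
alternate-preserves Pp Pq zero = Pp
alternate-preserves {P = P} Pp Pq (suc j) = alternate-preserves {P = P} Pq Pp j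

-- The cycle is v₁ … vₙ with vᵢ₊₁ at index i ≤ m, and u is at index u = m + 1.
module CycleWithApex (m : ℕ) (Li : ℕ → List ℕ)
  (unique : ∀ j → Unique (Li j)) (two : ∀ j → 2 ≤ length (Li j)) where

  u : ℕ
  u = suc m

  some-colour : ∀ j → ∃[ y ] y ∈ Li j
  some-colour j with find (length<⇒⊈ {B = []} (unique j) (<⇒≤ (two j)))
  ... | y , y∈ , _ = y , y∈

  another : ∀ j x → ∃[ y ] y ∈ Li j × y ≢ x
  another j x with find (length<⇒⊈ {B = x ∷ []} (unique j) (two j))
  ... | y , y∈ , y∉[x] = y , y∈ , y∉[x] ∘ here

  record ProperOn (a b : ℕ) (f : ℕ → ℕ) : Set where
    field
      ∈-list : ∀ {j} → a ≤ j → j ≤ b → f j ∈ Li j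
      ≢-next : ∀ {j} → a ≤ j → j < b → f j ≢ f (suc j)
  open ProperOn

  glue-proper : ∀ {a b i g h} → ProperOn a i g → ProperOn (suc i) b h → g i ≢ h (suc i)
    → ProperOn a b (glue i g h)
  glue-proper {a} {b} {i} {g} {h} G H gᵢ≢hᵢ₊₁ = record { ∈-list = glue-∈ ; ≢-next = glue-≢ }
    where
    glue≡g : ∀ {j} → j ≤ i → glue i g h j ≡ g j
    glue≡g = glue-≤
    glue≡h : ∀ {j} → i < j → glue i g h j ≡ h j
    glue≡h = glue->
    glue-∈ : ∀ {j} → a ≤ j → j ≤ b → glue i g h j ∈ Li j
    glue-∈ {j} a≤j j≤b with j ≤? i
    ... | yes j≤i = G .∈-list a≤j j≤i
    ... | no j≰i = H .∈-list (≰⇒> j≰i) j≤b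
    glue-≢ : ∀ {j} → a ≤ j → j < b → glue i g h j ≢ glue i g h (suc j)
    glue-≢ {j} a≤j j<b with <-cmp j i
    ... | tri< j<i _ _ rewrite glue≡g (<⇒≤ j<i) | glue≡g j<i =
      G .≢-next a≤j j<i
    ... | tri≈ _ refl _ rewrite glue≡g (≤-refl {j}) | glue≡h (n<1+n j) =
      gᵢ≢hᵢ₊₁
    ... | tri> _ _ i<j rewrite glue≡h i<j | glue≡h (m<n⇒m<1+n i<j) =
      H .≢-next i<j j<b

  walkFrom : ℕ → ℕ → ℕ → ℕ
  walkFrom s x zero = x
  walkFrom s x (suc t) = avoid (Li (suc t + s)) (walkFrom s x t ∷ [])

  walkFrom-∈ : ∀ {s x} → x ∈ Li s → ∀ t → walkFrom s x t ∈ Li (t + s)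
  walkFrom-∈ x∈ zero = x∈
  walkFrom-∈ x∈ (suc t) = proj₁ (avoid-∈∉ (length<⇒⊈ (unique _) (two _)))

  walkFrom-≢ : ∀ s x t → walkFrom s x t ≢ walkFrom s x (suc t)
  walkFrom-≢ s x t = ≢-sym (proj₂ (avoid-∈∉ (length<⇒⊈ (unique _) (two _))) ∘ here)

  upFrom : ℕ → ℕ → ℕ → ℕ
  upFrom s x j = walkFrom s x (j ∸ s)

  upFrom-start : ∀ s x → upFrom s x s ≡ x
  upFrom-start s x = cong (walkFrom s x) (n∸n≡0 s)

  upFrom-∈ : ∀ {s x j} → x ∈ Li s → s ≤ j → upFrom s x j ∈ Li j
  upFrom-∈ {s} {x} {j} x∈ s≤j =
    subst (λ k → upFrom s x j ∈ Li k) (m∸n+n≡m s≤j) (walkFrom-∈ x∈ (j ∸ s))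

  upFrom-≢ : ∀ {s j} x → s ≤ j → upFrom s x j ≢ upFrom s x (suc j)
  upFrom-≢ {s} {j} x s≤j =
    subst (λ t → upFrom s x j ≢ walkFrom s x t) (sym (+-∸-assoc 1 s≤j)) (walkFrom-≢ s x (j ∸ s))

  upFrom-proper : ∀ {s b x} → x ∈ Li s → ProperOn s b (upFrom s x)
  upFrom-proper {x = x} x∈ = record
    { ∈-list = λ s≤j _ → upFrom-∈ x∈ s≤j ; ≢-next = λ s≤j _ → upFrom-≢ x s≤j }

  record Colouring : Set where
    field
      cycle : ℕ → ℕ
      apex : ℕ
      cycle-proper : ProperOn 0 m cycle
      cycle-closed : cycle m ≢ cycle 0
      apex-∈ : apex ∈ Li u
      apex-≢₀ : apex ≢ cycle 0
      apex-≢ₘ : apex ≢ cycle m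

    colour : ℕ → ℕ
    colour = glue m cycle (λ _ → apex)

    colour-≤m : ∀ {j} → j ≤ m → colour j ≡ cycle j
    colour-≤m = glue-≤

    colour-u : colour u ≡ apex
    colour-u = glue-> (n<1+n m)

    colour-∈ : ∀ {j} → j ≤ u → colour j ∈ Li j
    colour-∈ {j} j≤u with m≤n⇒m<n∨m≡n j≤u
    ... | inj₁ (s≤s j≤m) = subst (_∈ Li j) (sym (colour-≤m j≤m)) (cycle-proper .∈-list z≤n j≤m)
    ... | inj₂ refl = subst (_∈ Li u) (sym colour-u) apex-∈

    colour-cycleEdge : ∀ {i j} → CycleEdge u i j → colour i ≢ colour j
    colour-cycleEdge (inj₁ (s≤s i<m , refl)) rewrite colour-≤m (<⇒≤ i<m) | colour-≤m i<m =
      cycle-proper .≢-next z≤n i<m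
    colour-cycleEdge (inj₂ (refl , refl)) rewrite colour-≤m (≤-refl {m}) | colour-≤m (z≤n {m}) =
      cycle-closed

    colour-uEdge : ∀ {i j} → UEdge u i j → colour i ≢ colour j
    colour-uEdge (refl , inj₁ refl) rewrite colour-u | colour-≤m (z≤n {m}) = apex-≢₀
    colour-uEdge (refl , inj₂ refl) rewrite colour-u | colour-≤m (≤-refl {m}) = apex-≢ₘ

    colour-Adj : ∀ {v w} → Adj u v w → colour (toℕ v) ≢ colour (toℕ w)
    colour-Adj (inj₁ e) = colour-cycleEdge e
    colour-Adj (inj₂ (inj₁ e)) = ≢-sym (colour-cycleEdge e)
    colour-Adj (inj₂ (inj₂ (inj₁ e))) = colour-uEdge e
    colour-Adj (inj₂ (inj₂ (inj₂ e))) = ≢-sym (colour-uEdge e)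

  two-walks-colouring : ∀ {i x γ Y} → i < m → x ∈ Li 0 → γ ∈ Li (suc i)
    → upFrom 0 x i ≢ γ → upFrom (suc i) γ m ≢ x
    → Y ∈ Li u → Y ≢ x → Y ≢ upFrom (suc i) γ m → Colouring
  two-walks-colouring {i} {x} {γ} {Y} i<m x∈ γ∈ xᵢ≢γ cₘ≢x Y∈ Y≢x Y≢cₘ = record
    { cycle = c
    ; apex = Y
    ; cycle-proper = glue-proper (upFrom-proper x∈) (upFrom-proper γ∈)
                                 (subst (upFrom 0 x i ≢_) (sym (upFrom-start (suc i) γ)) xᵢ≢γ)
    ; cycle-closed = subst₂ _≢_ (sym cₘ) (sym c₀) cₘ≢x
    ; apex-∈ = Y∈
    ; apex-≢₀ = subst (Y ≢_) (sym c₀) Y≢x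
    ; apex-≢ₘ = subst (Y ≢_) (sym cₘ) Y≢cₘ
    }
    where
    c = glue i (upFrom 0 x) (upFrom (suc i) γ)
    c₀ : c 0 ≡ x
    c₀ = refl
    cₘ : c m ≡ upFrom (suc i) γ m
    cₘ = glue-> i<m

  v₀-last : ∀ {β Y} → 1 ≤ m → β ∈ Li 1 → Y ∈ Li u → Y ≢ upFrom 1 β m
    → Li 0 ⊈ (β ∷ upFrom 1 β m ∷ Y ∷ []) → Colouring
  v₀-last {β} {Y} 1≤m β∈ Y∈ Y≢cₘ L₀⊈S with find L₀⊈S
  ... | X , X∈ , X∉S = two-walks-colouring 1≤m X∈ β∈ (X∉S ∘ here)
                         (X∉S ∘ there ∘ here ∘ sym) Y∈ (X∉S ∘ there ∘ there ∘ here ∘ sym) Y≢cₘ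

  apex-preferring : ∀ {π} c → π ∈ Li u → ∃[ Y ] Y ∈ Li u × Y ≢ c × π ∈ (c ∷ Y ∷ [])
  apex-preferring {π} c π∈ with π ≟ c
  ... | no π≢c = π , π∈ , π≢c , there (here refl)
  ... | yes π≡c with another u c
  ...   | Y , Y∈ , Y≢c = Y , Y∈ , Y≢c , here π≡c

  colouring-L₁⊈L₀ : ∀ {β} → 1 ≤ m → 3 ≤ length (Li 0) → β ∈ Li 1 → β ∉ Li 0 → Colouring
  colouring-L₁⊈L₀ {β} 1≤m 3≤|L₀| β∈L₁ β∉L₀ with another u (upFrom 1 β m)
  ... | Y , Y∈ , Y≢cₘ = v₀-last 1≤m β∈L₁ Y∈ Y≢cₘ (length≤⇒⊈ (unique 0) (here β∉L₀) 3≤|L₀|)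

  colouring-Lᵤ⊈L₀ : ∀ {α} → 1 ≤ m → 3 ≤ length (Li 0) → α ∈ Li u → α ∉ Li 0 → Colouring
  colouring-Lᵤ⊈L₀ 1≤m 3≤|L₀| α∈Lᵤ α∉L₀ with some-colour 1
  ... | β , β∈L₁ with apex-preferring (upFrom 1 β m) α∈Lᵤ
  ...   | Y , Y∈ , Y≢cₘ , α∈cₘY =
    v₀-last 1≤m β∈L₁ Y∈ Y≢cₘ (length≤⇒⊈ (unique 0) (lose (there α∈cₘY) α∉L₀) 3≤|L₀|)

  colouring-L₁∩Lᵤ : ∀ {β} → 1 ≤ m → 3 ≤ length (Li 0) → β ∈ Li 1 → β ∈ Li u → Colouring
  colouring-L₁∩Lᵤ {β} 1≤m 3≤|L₀| β∈L₁ β∈Lᵤ with apex-preferring (upFrom 1 β m) β∈Lᵤ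
  ... | Y , Y∈ , Y≢cₘ , β∈cₘY =
    v₀-last 1≤m β∈L₁ Y∈ Y≢cₘ (⊈-∷ β∈cₘY (length<⇒⊈ (unique 0) 3≤|L₀|))

  colouring-|L₀|≥4 : 1 ≤ m → 4 ≤ length (Li 0) → Colouring
  colouring-|L₀|≥4 1≤m 4≤|L₀| with some-colour 1
  ... | β , β∈L₁ with another u (upFrom 1 β m)
  ...   | Y , Y∈ , Y≢cₘ = v₀-last 1≤m β∈L₁ Y∈ Y≢cₘ (length<⇒⊈ (unique 0) 4≤|L₀|)

  colouring-|L₀|≥3 : 1 ≤ m → 3 ≤ length (Li 0) → Colouring
  colouring-|L₀|≥3 1≤m 3≤|L₀| with ⊈-or-⊆ (Li 1) (Li 0)
  ... | inj₁ L₁⊈L₀ with find L₁⊈L₀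
  ...   | _ , β∈L₁ , β∉L₀ = colouring-L₁⊈L₀ 1≤m 3≤|L₀| β∈L₁ β∉L₀
  colouring-|L₀|≥3 1≤m 3≤|L₀| | inj₂ L₁⊆L₀ with ⊈-or-⊆ (Li u) (Li 0)
  ... | inj₁ Lᵤ⊈L₀ with find Lᵤ⊈L₀
  ...   | _ , α∈Lᵤ , α∉L₀ = colouring-Lᵤ⊈L₀ 1≤m 3≤|L₀| α∈Lᵤ α∉L₀
  colouring-|L₀|≥3 1≤m 3≤|L₀| | inj₂ L₁⊆L₀ | inj₂ Lᵤ⊆L₀ with any? (_∈? Li u) (Li 1)
  ... | yes L₁∩Lᵤ with find L₁∩Lᵤ
  ...   | _ , β∈L₁ , β∈Lᵤ = colouring-L₁∩Lᵤ 1≤m 3≤|L₀| β∈L₁ β∈Lᵤ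
  colouring-|L₀|≥3 1≤m 3≤|L₀| | inj₂ L₁⊆L₀ | inj₂ Lᵤ⊆L₀ | no L₁∩Lᵤ≡∅ =
    colouring-|L₀|≥4 1≤m
      (≤-trans (+-mono-≤ (two 1) (two u))
               (disjoint-⊆⇒length+length≤ (unique 1) (unique u)
                  (λ (x∈L₁ , x∈Lᵤ) → L₁∩Lᵤ≡∅ (lose x∈L₁ x∈Lᵤ)) L₁⊆L₀ Lᵤ⊆L₀))

  v₀-colour-freeing-apex : ∀ {α} → α ∈ Li u → α ∉ Li 0 → ∀ c
    → ∃[ x ] x ∈ Li 0 × x ≢ c × Li u ⊈ (x ∷ c ∷ [])
  v₀-colour-freeing-apex {α} α∈Lᵤ α∉L₀ c with α ≟ c
  ... | no α≢c with another 0 c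
  ...   | x , x∈ , x≢c =
    x , x∈ , x≢c , lose α∈Lᵤ λ { (here refl) → α∉L₀ x∈ ; (there (here α≡c)) → α≢c α≡c }
  v₀-colour-freeing-apex {α} α∈Lᵤ α∉L₀ c | yes refl with some-colour 0
  ... | a , a∈ with another 0 a | ⊈-or-⊆ (Li u) (a ∷ α ∷ [])
  ...   | _ | inj₁ Lᵤ⊈aα = a , a∈ , (λ { refl → α∉L₀ a∈ }) , Lᵤ⊈aα
  ...   | b , b∈ , b≢a | inj₂ Lᵤ⊆aα with another u α
  ...     | y , y∈ , y≢α =
    b , b∈ , (λ { refl → α∉L₀ b∈ }) ,
    lose y∈ λ { (here refl) → b∉Lᵤ y∈ ; (there (here y≡α)) → y≢α y≡α }
    where
    b∉Lᵤ : b ∉ Li u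
    b∉Lᵤ b∈Lᵤ with Lᵤ⊆aα b∈Lᵤ
    ... | here b≡a = b≢a b≡a
    ... | there (here refl) = α∉L₀ b∈

  colouring-jump : ∀ {α i γ} → α ∈ Li u → α ∉ Li 0 → i < m → γ ∈ Li (suc i) → γ ∉ Li i
    → Colouring
  colouring-jump {i = i} {γ} α∈Lᵤ α∉L₀ i<m γ∈ γ∉ with v₀-colour-freeing-apex α∈Lᵤ α∉L₀ (upFrom (suc i) γ m)
  ... | x , x∈ , x≢cₘ , Lᵤ⊈xcₘ with find Lᵤ⊈xcₘ
  ...   | Y , Y∈ , Y∉xcₘ =
    two-walks-colouring i<m x∈ γ∈
      (λ xᵢ≡γ → γ∉ (subst (_∈ Li i) xᵢ≡γ (upFrom-∈ x∈ z≤n)))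
      (x≢cₘ ∘ sym) Y∈ (Y∉xcₘ ∘ here) (Y∉xcₘ ∘ there ∘ here)

  descending-or-jump : ∀ k
    → (∃[ i ] i < k × Li (suc i) ⊈ Li i) ⊎ (∀ {i} → i < k → Li (suc i) ⊆ Li i)
  descending-or-jump zero = inj₂ λ ()
  descending-or-jump (suc k) with descending-or-jump k
  ... | inj₁ (i , i<k , jump) = inj₁ (i , m<n⇒m<1+n i<k , jump)
  ... | inj₂ desc with ⊈-or-⊆ (Li (suc k)) (Li k)
  ...   | inj₁ jump = inj₁ (k , ≤-refl , jump)
  ...   | inj₂ Lₖ₊₁⊆Lₖ = inj₂ λ i<1+k → [ desc , (λ { refl → Lₖ₊₁⊆Lₖ }) ]′ (m<1+n⇒m<n∨m≡n i<1+k)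

  descending-⊆ : (∀ {i} → i < m → Li (suc i) ⊆ Li i) → ∀ {j} → j ≤ m → Li j ⊆ Li 0
  descending-⊆ desc {zero} _ = id
  descending-⊆ desc {suc j} j<m = descending-⊆ desc (<⇒≤ j<m) ∘ desc j<m

  colouring-descending : ∀ {α} → length (Li 0) ≤ 2 → 2 ∣ u → α ∈ Li u → α ∉ Li 0
    → (∀ {i} → i < m → Li (suc i) ⊆ Li i) → Colouring
  colouring-descending {α} |L₀|≤2 (divides k u≡2k) α∈Lᵤ α∉L₀ desc with some-colour 0
  ... | p , p∈ with another 0 p
  ...   | q , q∈ , q≢p = record
    { cycle = c
    ; apex = α
    ; cycle-proper = record { ∈-list = λ {j} _ j≤m → L₀⊆Lⱼ j≤m (c∈L₀ j) ; ≢-next = λ {j} _ _ → alternate-≢ p≢q j }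
    ; cycle-closed = λ cₘ≡p → alternate-≢ p≢q m (trans cₘ≡p (sym c-wraps))
    ; apex-∈ = α∈Lᵤ
    ; apex-≢₀ = λ { refl → α∉L₀ p∈ }
    ; apex-≢ₘ = λ α≡cₘ → α∉L₀ (subst (_∈ Li 0) (sym α≡cₘ) (c∈L₀ m))
    }
    where
    p≢q = ≢-sym q≢p
    c = alternate p q
    c∈L₀ : ∀ j → c j ∈ Li 0
    c∈L₀ = alternate-preserves {P = _∈ Li 0} p∈ q∈
    c-wraps : c u ≡ p
    c-wraps = trans (cong c u≡2k) (alternate-even k)
    L₀⊆Lⱼ : ∀ {j} → j ≤ m → Li 0 ⊆ Li j
    L₀⊆Lⱼ j≤m = ⊆∧length≤⇒⊇ (unique _) (descending-⊆ desc j≤m) (≤-trans |L₀|≤2 (two _))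

  colouring-|L₀|≤2 : length (Li 0) ≤ 2 → 2 ∣ u → ¬ SameSet (Li 0) (Li u) → Colouring
  colouring-|L₀|≤2 |L₀|≤2 2∣u L₀≠Lᵤ with ⊈-or-⊆ (Li u) (Li 0)
  ... | inj₂ Lᵤ⊆L₀ =
    contradiction (λ x → ⊆∧length≤⇒⊇ (unique u) Lᵤ⊆L₀ (≤-trans |L₀|≤2 (two u)) , Lᵤ⊆L₀) L₀≠Lᵤ
  ... | inj₁ Lᵤ⊈L₀ with find Lᵤ⊈L₀
  ...   | _ , α∈Lᵤ , α∉L₀ with descending-or-jump m
  ...     | inj₂ desc = colouring-descending |L₀|≤2 2∣u α∈Lᵤ α∉L₀ desc
  ...     | inj₁ (i , i<m , jump) with find jump
  ...       | _ , γ∈ , γ∉ = colouring-jump α∈Lᵤ α∉L₀ i<m γ∈ γ∉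

  colouring : 1 ≤ m → 3 ≤ length (Li 0) ⊎ (2 ∣ u × ¬ SameSet (Li 0) (Li u)) → Colouring
  colouring 1≤m hyp with 3 ≤? length (Li 0) | hyp
  ... | yes 3≤|L₀| | _ = colouring-|L₀|≥3 1≤m 3≤|L₀|
  ... | no 3≰|L₀| | inj₁ 3≤|L₀| = contradiction 3≤|L₀| 3≰|L₀|
  ... | no 3≰|L₀| | inj₂ (2∣u , L₀≠Lᵤ) with ≰⇒> 3≰|L₀|
  ...   | s≤s |L₀|≤2 = colouring-|L₀|≤2 |L₀|≤2 2∣u L₀≠Lᵤ

-- Indices above n are clamped to n, so that the list hypotheses hold at every index.
vertex : (n : ℕ) → ℕ → Fin (suc n)
vertex n j = fromℕ< (s≤s (m⊓n≤n j n))

vertex-toℕ : ∀ {n} (v : Fin (suc n)) → vertex n (toℕ v) ≡ v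
vertex-toℕ v = toℕ-injective (trans (toℕ-fromℕ< _) (m≤n⇒m⊓n≡m (toℕ≤pred[n] v)))

lemma4 : (n : ℕ) → 3 ≤ n → (L : ListAssignment n)
    → (∀ v → Unique (L v))
    → (∀ v → 2 ≤ ∣ L v ∣ₗ)
    → (3 ≤ ∣ L zero ∣ₗ ⊎ (2 ∣ n × ¬ SameSet (L zero) (L (fromℕ n))))
    → Σ (Fin (ℕ.suc n) → ℕ) (λ c → ProperLColoring n L c)
lemma4 (suc m) (s≤s 2≤m) L unique two hyp = colour ∘ toℕ , colour-∈L , λ _ _ → colour-Adj
  where
  Li : ℕ → List ℕ
  Li = L ∘ vertex (suc m)
  L-fromℕ : L (fromℕ (suc m)) ≡ Li (suc m)
  L-fromℕ = trans (cong L (sym (vertex-toℕ (fromℕ (suc m))))) (cong Li (toℕ-fromℕ (suc m)))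
  open CycleWithApex m Li (unique ∘ vertex (suc m)) (two ∘ vertex (suc m))
  hyp′ : 3 ≤ length (Li 0) ⊎ (2 ∣ u × ¬ SameSet (Li 0) (Li u))
  hyp′ = Sum.map₂ (Prod.map₂ (subst (¬_ ∘ SameSet (Li 0)) L-fromℕ)) hyp
  open Colouring (colouring (<⇒≤ 2≤m) hyp′)
  colour-∈L : ∀ v → colour (toℕ v) ∈ L v
  colour-∈L v = subst (colour (toℕ v) ∈_) (cong L (vertex-toℕ v)) (colour-∈ (toℕ≤pred[n] v))
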